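{- Let $\mathbf T$ be a countable homogeneous tournament with its fixed expansion $\mathbf T^*$ (described in the context). If $\mathrm{Age}(\mathbf T^*)$ has the expansion property relative to $\mathrm{Age}(\mathbf T)$, then $\mathrm{Age}(I_\omega[\mathbf T]^*)$ has the expansion property relative to $\mathrm{Age}(I_\omega[\mathbf T])$.
   Context: The countable homogeneous tournaments are $I_1$, the 3-cycle $C_3$ on $\{0,1,2\}$, $\mathbb Q$ (with $E(x,y)$ iff $x<y$), the dense local order $\mathbf S(2)$ (a countable dense subset $D$ of the unit circle with no antipodal points and not containing the points at angles $\pi/2,3\pi/2$, with $E(x,y)$ iff the counterclockwise angle from $x$ to $y$ is in $(0,\pi)$), and the generic tournament $T^\omega$. Fixed expansions $\mathbf T^*$, containing $E$ and a binary $<$ interpreted as a linear order $<^*$: $I_1^*$ adds one unary predicate true at its vertex; $C_3^*$ adds three unary predicates, the $i$-th true exactly at $i$, and a fixed linear order; $\mathbb Q^*$ adds the usual order; $\mathbf S(2)^*$ adds two unary predicates for the two halves of $D$ cut by the line through angles $\pi/2,3\pi/2$ and the order $x<y$ iff ($x,y$ in the same half and $E(x,y)$) or (different halves and $E(y,x)$); $T^{\omega*}$ is the Fraïssé limit of all finite linearly ordered tournaments. $I_\omega[\mathbf T]$ is the disjoint union of countably many copies of $\mathbf T$: universe $\mathbb N\times T$, $E((i,x),(j,y))$ iff $i=j$ and $E^{\mathbf T}(x,y)$. $I_\omega[\mathbf T]^*$ has the same universe; for each relation $R$ of $\mathbf T^*$ other than $<$, $R((k_1,x_1),\dots,(k_m,x_m))$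 iff $k_1=\dots=k_m$ and $R^{\mathbf T^*}(x_1,\dots,x_m)$; $(i,x)<(j,y)$ iff $i\prec j$ or ($i=j$ and $x<^*y$), with $\prec$ a dense linear order on $\mathbb N$. If $\mathcal K^*$ is a class of expansions of members of $\mathcal K$, it has the expansion property relative to $\mathcal K$ if for every $\mathbf A\in\mathcal K$ there is $\mathbf B\in\mathcal K$ such that every expansion of $\mathbf A$ in $\mathcal K^*$ embeds in every expansion of $\mathbf B$ in $\mathcal K^*$. The age of a structure is the class of finite structures embeddable in it. -}

module Defs where

open import Data.Nat as ℕ using (ℕ; zero; suc; _%_; _≡ᵇ_)
open import Data.Fin as Fin using (Fin; zero; suc)
open import Data.Bool using (Bool; true; false; T; not; _∧_; _xor_)
open import Data.Product using (Σ; Σ-syntax; ∃; _×_; _,_)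
open import Data.Sum using (_⊎_)
open import Data.Unit using (⊤)
open import Data.Empty using (⊥)
open import Data.Integer as ℤ using (+_)
open import Data.Rational as ℚ using (ℚ; _/_; 0ℚ; 1ℚ; ½; ↧ₙ_)
open import Data.Rational.Properties as ℚP using ()
open import Relation.Binary.PropositionalEquality using (_≡_; _≢_)
open import Relation.Binary.Structures using (IsStrictTotalOrder)
open import Relation.Nullary.Decidable using (⌊_⌋)
open import Function.Definitions using (Injective; Bijective)

record Tour : Set₁ where
  field
    Car : Set
    E   : Car → Car → Set

record Str (k : ℕ) : Set₁ where
  field
    Car : Set
    E   : Car → Car → Set
    L   : Car → Car → Set          -- the linear order <
    P   : Fin k → Car → Set

open Tour
open Str

reduct : ∀ {k} → Str k → Tour
reduct M = record { Car = Str.Car M ; E = Str.E M }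

_⟺_ : Set → Set → Set
A ⟺ B = (A → B) × (B → A)
infix 3 _⟺_

-- Finite structures (universe Fin n; every finite structure is
-- isomorphic to one of these)

record FinTour : Set where
  constructor finTour
  field
    size : ℕ
    e    : Fin size → Fin size → Bool

open FinTour

record Exp (k : ℕ) (A : FinTour) : Set where
  constructor exp
  field
    l : Fin (size A) → Fin (size A) → Bool
    p : Fin k → Fin (size A) → Bool

open Exp

-- A embeds in M  (i.e. A ∈ Age M)
EmbedsT : FinTour → Tour → Set
EmbedsT A M =
  Σ[ f ∈ (Fin (size A) → Tour.Car M) ]
    Injective _≡_ _≡_ f ×
    (∀ a b → T (e A a b) ⟺ Tour.E M (f a) (f b))

-- the expansion (A , x) embeds in M  (i.e. (A , x) ∈ Age M)
EmbedsS : ∀ {k} (A : FinTour) → Exp k A → Str k → Set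
EmbedsS A x M =
  Σ[ f ∈ (Fin (size A) → Str.Car M) ]
    Injective _≡_ _≡_ f ×
    (∀ a b → T (e A a b) ⟺ Str.E M (f a) (f b)) ×
    (∀ a b → T (l x a b) ⟺ Str.L M (f a) (f b)) ×
    (∀ i a → T (p x i a) ⟺ Str.P M i (f a))

EmbedsFin : ∀ {k} (A : FinTour) → Exp k A → (B : FinTour) → Exp k B → Set
EmbedsFin A x B y =
  Σ[ f ∈ (Fin (size A) → Fin (size B)) ]
    Injective _≡_ _≡_ f ×
    (∀ a b → e A a b ≡ e B (f a) (f b)) ×
    (∀ a b → l x a b ≡ l y (f a) (f b)) ×
    (∀ i a → p x i a ≡ p y i (f a))

ExpansionProperty : ∀ {k} → Tour → Str k → Set
ExpansionProperty Tr M =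
  ∀ (A : FinTour) → EmbedsT A Tr →
    Σ[ B ∈ FinTour ] EmbedsT B Tr ×
      (∀ (x : Exp _ A) → EmbedsS A x M →
       ∀ (y : Exp _ B) → EmbedsS B y M →
       EmbedsFin A x B y)

record DenseLinearOrder (_≺_ : ℕ → ℕ → Set) : Set where
  field
    isStrictTotalOrder : IsStrictTotalOrder _≡_ _≺_
    dense : ∀ i j → i ≺ j → Σ[ m ∈ ℕ ] (i ≺ m × m ≺ j)

Iω : Tour → Tour
Iω Tr = record
  { Car = ℕ × Tour.Car Tr
  ; E   = λ { (i , x) (j , y) → i ≡ j × Tour.E Tr x y }
  }

Iω* : ∀ {k} → (ℕ → ℕ → Set) → Str k → Str k
Iω* _≺_ M = record
  { Car = ℕ × Str.Car M
  ; E   = λ { (i , x) (j , y) → i ≡ j × Str.E M x y }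
  ; L   = λ { (i , x) (j , y) → i ≺ j ⊎ (i ≡ j × Str.L M x y) }
  ; P   = λ { r (i , x) → Str.P M r x }
  }

I₁ : Tour
I₁ = record { Car = ⊤ ; E = λ _ _ → ⊥ }

I₁* : Str 1
I₁* = record { Car = ⊤ ; E = λ _ _ → ⊥ ; L = λ _ _ → ⊥ ; P = λ _ _ → ⊤ }

c3e : Fin 3 → Fin 3 → Bool
c3e zero          (suc zero)       = true
c3e (suc zero)    (suc (suc zero)) = true
c3e (suc (suc zero)) zero          = true
c3e _ _ = false

C₃ : Tour
C₃ = record { Car = Fin 3 ; E = λ x y → T (c3e x y) }

C₃* : Str 3
C₃* = record
  { Car = Fin 3
  ; E   = λ x y → T (c3e x y)
  ; L   = Fin._<_
  ; P   = λ i x → i ≡ x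
  }

Qt : Tour
Qt = record { Car = ℚ ; E = ℚ._<_ }

Q* : Str 0
Q* = record { Car = ℚ ; E = ℚ._<_ ; L = ℚ._<_ ; P = λ () }

-- S(2) and S(2)*
-- A point of the unit circle at angle qπ is represented by q ∈ [0,2).
-- D = { qπ : q ∈ ℚ, 0 ≤ q < 2, q ≠ 3/2, (q < 1 ↔ denominator of q odd) }.
-- This is countable, dense in the circle, has no antipodal pair
-- (q and q+1 have the same denominator), and avoids π/2 and 3π/2.

3/2 : ℚ
3/2 = + 3 / 2

2ℚ : ℚ
2ℚ = + 2 / 1

-1ℚ : ℚ
-1ℚ = ℤ.-[1+ 0 ] / 1

odd : ℕ → Bool
odd n = n % 2 ≡ᵇ 1

inD : ℚ → Bool
inD q = ⌊ 0ℚ ℚP.≤? q ⌋ ∧ ⌊ q ℚP.<? 2ℚ ⌋ ∧ not ⌊ q ℚP.≟ 3/2 ⌋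
        ∧ not (⌊ q ℚP.<? 1ℚ ⌋ xor odd (↧ₙ q))

D : Set
D = Σ[ q ∈ ℚ ] T (inD q)

-- counterclockwise angle from x to y lies in (0, π)
s2E : D → D → Set
s2E (x , _) (y , _) =
  (0ℚ ℚ.< (y ℚ.- x) × (y ℚ.- x) ℚ.< 1ℚ) ⊎ (y ℚ.- x) ℚ.< -1ℚ

-- the two halves cut by the line through π/2 and 3π/2
rightHalf leftHalf : D → Set
rightHalf (q , _) = q ℚ.< ½ ⊎ 3/2 ℚ.< q
leftHalf  (q , _) = ½ ℚ.< q × q ℚ.< 3/2

sameHalf differentHalf : D → D → Set
sameHalf x y = (rightHalf x × rightHalf y) ⊎ (leftHalf x × leftHalf y)
differentHalf x y = (rightHalf x × leftHalf y) ⊎ (leftHalf x × rightHalf y)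

halfP : Fin 2 → D → Set
halfP zero    = rightHalf
halfP (suc _) = leftHalf

S2 : Tour
S2 = record { Car = D ; E = s2E }

S2* : Str 2
S2* = record
  { Car = D
  ; E   = s2E
  ; L   = λ x y → (sameHalf x y × s2E x y) ⊎ (differentHalf x y × s2E y x)
  ; P   = halfP
  }

-- T^ω* : Fraïssé limit of all finite linearly ordered tournaments
-- (characterised as the countable homogeneous structure with that age)

IsOrderedTournament : (A : FinTour) → Exp 0 A → Set
IsOrderedTournament A x =
  (∀ a → e A a a ≡ false) ×
  (∀ a b → a ≢ b → e A a b ≡ not (e A b a)) ×
  (∀ a → l x a a ≡ false) ×
  (∀ a b c → l x a b ≡ true → l x b c ≡ true → l x a c ≡ true) ×
  (∀ a b → a ≢ b → l x a b ≡ not (l x b a))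

Countable : Set → Set
Countable X = Σ[ f ∈ (X → ℕ) ] Injective _≡_ _≡_ f

IsAutomorphism : ∀ {k} (M : Str k) → (Str.Car M → Str.Car M) → Set
IsAutomorphism M σ =
  Bijective _≡_ _≡_ σ ×
  (∀ u v → Str.E M u v ⟺ Str.E M (σ u) (σ v)) ×
  (∀ u v → Str.L M u v ⟺ Str.L M (σ u) (σ v)) ×
  (∀ i u → Str.P M i u ⟺ Str.P M i (σ u))

-- every isomorphism between finite substructures (given as the map
-- f a ↦ g a between two injective enumerations) extends to an automorphism
Homogeneous : ∀ {k} → Str k → Set
Homogeneous M =
  ∀ (n : ℕ) (f g : Fin n → Str.Car M) →
    Injective _≡_ _≡_ f → Injective _≡_ _≡_ g →
    (∀ a b → Str.E M (f a) (f b) ⟺ Str.E M (g a) (g b)) →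
    (∀ a b → Str.L M (f a) (f b) ⟺ Str.L M (g a) (g b)) →
    (∀ i a → Str.P M i (f a) ⟺ Str.P M i (g a)) →
    Σ[ σ ∈ (Str.Car M → Str.Car M) ]
      IsAutomorphism M σ × (∀ a → σ (f a) ≡ g a)

record IsFraisseLimitOT (M : Str 0) : Set where
  field
    countable   : Countable (Str.Car M)
    homogeneous : Homogeneous M
    age         : ∀ (A : FinTour) (x : Exp 0 A) →
                    EmbedsS A x M ⟺ IsOrderedTournament A x

module Submission where

-- A finite A ⊆ Iω[T] splits into classes, one per block (copy of T)
-- it meets.  The expansion property of T gives, for each class A_i, a finite
-- B_i; jointly embed all B_i into one finite Hub ⊆ T and let the witness B be
-- |A| disjoint copies of Hub.  Given expansions x of A and y of B in the
-- ages, y places each copy of Hub in a single block of Iω[T]* and distinct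
-- copies in distinct blocks (T is a tournament, so the block partition is
-- read off the arcs).  Matching the classes of A with copies of Hub in the
-- order of their blocks, each class embeds in its copy through B_i, and these
-- partial embeddings glue to an embedding of (A, x) into (B, y).

open import Defs
open import Data.Nat as ℕ using (ℕ; zero; suc; _*_)
import Data.Nat.Properties as ℕP
import Data.Rational as ℚ
import Data.Rational.Properties as ℚP
open import Data.Fin
  using (Fin; zero; suc; toℕ; fromℕ<; punchOut; combine; remQuot; splitAt; _↑ˡ_; _↑ʳ_)
import Data.Fin as Fin
import Data.Fin.Properties as FinP
open import Data.Fin.Subset using (Subset; _∈_; _∉_; _⊂_; ∣_∣; ⊤)
import Data.Fin.Subset.Properties as SubsetP
open import Data.Bool using (Bool; true; false; T; not; _∧_)
open import Data.Vec as Vec using ()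
import Data.Vec.Properties as VecP
open import Data.Product using (Σ; Σ-syntax; ∃; _×_; _,_; proj₁; proj₂)
open import Data.Sum using (_⊎_; inj₁; inj₂)
open import Data.Empty using (⊥; ⊥-elim)
open import Data.List using (List; _∷_; length; lookup; filter; allFin; tabulate; _++_; deduplicate)
open import Data.List.Relation.Unary.Unique.Propositional using (Unique)
import Data.List.Relation.Unary.Unique.Propositional.Properties as UniqueP
import Data.List.Relation.Unary.Unique.DecPropositional.Properties as DedupP
import Data.List.Relation.Unary.All as All
open import Data.List.Relation.Unary.AllPairs using (_∷_)
import Data.List.Relation.Unary.Any as Any
import Data.List.Relation.Unary.Any.Properties as AnyP
import Data.List.Membership.Propositional as ListMem
import Data.List.Membership.Propositional.Properties as ListMemP
open import Relation.Nullary using (¬_; Dec; yes; no)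
open import Relation.Nullary.Decidable
  using (⌊_⌋; toWitness; fromWitness; _×-dec_; _⊎-dec_; ¬¬-excluded-middle; decidable-stable)
open import Relation.Binary.PropositionalEquality
open import Relation.Binary.Structures using (IsStrictTotalOrder)
open import Relation.Binary.Definitions using (DecidableEquality; tri<; tri≈; tri>)
open import Function.Definitions using (Injective)
open import Function.Bundles using (Equivalence)
open import Function using (_∘′_)
import Data.Bool.Properties as BoolP

open FinTour
open Exp

T-extensional : ∀ {x y : Bool} → (T x → T y) → (T y → T x) → x ≡ y
T-extensional {false} {false} _ _ = refl
T-extensional {false} {true}  _ g = ⊥-elim (g _)
T-extensional {true}  {false} f _ = ⊥-elim (f _)
T-extensional {true}  {true}  _ _ = refl

reflects⇒≡⌊⌋ : ∀ {x : Bool} {P : Set} → (T x ⟺ P) → (d : Dec P) → x ≡ ⌊ d ⌋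
reflects⇒≡⌊⌋ (to , from) d =
  T-extensional (λ t → fromWitness (to t)) (λ t → from (toWitness t))

⌊⌋-true : ∀ {P : Set} (d : Dec P) → P → ⌊ d ⌋ ≡ true
⌊⌋-true d p = Equivalence.to BoolP.T-≡ (fromWitness p)

⌊⌋-true⁻¹ : ∀ {P : Set} (d : Dec P) → ⌊ d ⌋ ≡ true → P
⌊⌋-true⁻¹ d eq = toWitness (Equivalence.from BoolP.T-≡ eq)

⌊⌋-false : ∀ {P : Set} (d : Dec P) → ¬ P → ⌊ d ⌋ ≡ false
⌊⌋-false d ¬p = T-extensional (λ t → ⊥-elim (¬p (toWitness t))) (λ ())

injective⇒surjective : ∀ {n} (f : Fin n → Fin n) → Injective _≡_ _≡_ f →
  ∀ r → ∃ λ c → f c ≡ r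
injective⇒surjective f f-inj r with FinP.any? (λ c → f c FinP.≟ r)
... | yes found = found
injective⇒surjective {suc n} f f-inj r | no missed =
  ⊥-elim (ℕP.1+n≰n (FinP.injective⇒≤ avoid-r-injective))
  where
  avoid-r : Fin (suc n) → Fin n
  avoid-r c = punchOut {i = r} {j = f c} (λ r≡fc → missed (c , sym r≡fc))
  avoid-r-injective : Injective _≡_ _≡_ avoid-r
  avoid-r-injective eq = f-inj (FinP.punchOut-injective {i = r} _ _ eq)

∈-tabulate⁺ : ∀ {N} (f : Fin N → Bool) b → T (f b) → b ∈ Vec.tabulate f
∈-tabulate⁺ f b t = VecP.lookup⇒[]= b (Vec.tabulate f)
  (trans (VecP.lookup∘tabulate f b) (Equivalence.to BoolP.T-≡ t))

∈-tabulate⁻ : ∀ {N} (f : Fin N → Bool) b → b ∈ Vec.tabulate f → T (f b)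
∈-tabulate⁻ f b b∈ = Equivalence.from BoolP.T-≡
  (trans (sym (VecP.lookup∘tabulate f b)) (VecP.[]=⇒lookup b∈))

-- Let α be any finite family in a strict total order
-- and β an injective family of the same size.  Sending the element of
-- rank r in α to the element of rank r in β preserves the order; the main
-- construction uses this to match the blocks of a small structure with
-- copies inside a big one.
module OrderMatching {A : Set} {_<_ : A → A → Set}
                     (sto : IsStrictTotalOrder _≡_ _<_) where

  open IsStrictTotalOrder sto using (compare; irrefl; _<?_)
    renaming (trans to <-trans)

  module Rank {N : ℕ} (α : Fin N → A) where

    below : Fin N → Subset N
    below a = Vec.tabulate (λ b → ⌊ α b <? α a ⌋)

    ∈-below⁺ : ∀ {a b} → α b < α a → b ∈ below a
    ∈-below⁺ {a} {b} lt = ∈-tabulate⁺ _ b (fromWitness lt)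

    ∈-below⁻ : ∀ {a b} → b ∈ below a → α b < α a
    ∈-below⁻ {a} {b} b∈ = toWitness (∈-tabulate⁻ _ b b∈)

    ∉-below : ∀ a → a ∉ below a
    ∉-below a a∈ = irrefl refl (∈-below⁻ a∈)

    below-⊂ : ∀ {a a'} → α a < α a' → below a ⊂ below a'
    below-⊂ lt = (λ b∈ → ∈-below⁺ (<-trans (∈-below⁻ b∈) lt)) , _ , ∈-below⁺ lt , ∉-below _

    rank : Fin N → Fin N
    rank a = fromℕ< (subst (∣ below a ∣ ℕ.<_) (SubsetP.∣⊤∣≡n N)
      (SubsetP.p⊂q⇒∣p∣<∣q∣ ((λ _ → SubsetP.∈⊤) , a , SubsetP.∈⊤ , ∉-below a)))

    rank-mono : ∀ {a a'} → α a < α a' → toℕ (rank a) ℕ.< toℕ (rank a')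
    rank-mono {a} {a'} lt = subst₂ ℕ._<_ (sym (FinP.toℕ-fromℕ< _)) (sym (FinP.toℕ-fromℕ< _))
      (SubsetP.p⊂q⇒∣p∣<∣q∣ (below-⊂ lt))

  module _ {N : ℕ} (α β : Fin N → A) (β-inj : Injective _≡_ _≡_ β) where

    private
      module Rα = Rank α
      module Rβ = Rank β

    rankβ-reflects : ∀ c c' → toℕ (Rβ.rank c) ℕ.< toℕ (Rβ.rank c') → β c < β c'
    rankβ-reflects c c' lt with compare (β c) (β c')
    ... | tri< β< _ _ = β<
    ... | tri≈ _ β≡ _ rewrite β-inj β≡ = ⊥-elim (ℕP.<-irrefl refl lt)
    ... | tri> _ _ β> = ⊥-elim (ℕP.<-asym lt (Rβ.rank-mono β>))

    rankβ-injective : Injective _≡_ _≡_ Rβ.rank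
    rankβ-injective {c} {c'} eq with compare (β c) (β c')
    ... | tri< β< _ _ = ⊥-elim (ℕP.<-irrefl (cong toℕ eq) (Rβ.rank-mono β<))
    ... | tri≈ _ β≡ _ = β-inj β≡
    ... | tri> _ _ β> = ⊥-elim (ℕP.<-irrefl (cong toℕ (sym eq)) (Rβ.rank-mono β>))

    -- opaque: only the stated property of σ is ever used
    opaque
      orderMatch : Σ[ σ ∈ (Fin N → Fin N) ] (∀ a a' → α a < α a' → β (σ a) < β (σ a'))
      orderMatch = σ , σ-mono
        where
        σ : Fin N → Fin N
        σ a = proj₁ (injective⇒surjective Rβ.rank rankβ-injective (Rα.rank a))
        rank-σ : ∀ a → Rβ.rank (σ a) ≡ Rα.rank a
        rank-σ a = proj₂ (injective⇒surjective Rβ.rank rankβ-injective (Rα.rank a))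
        σ-mono : ∀ a a' → α a < α a' → β (σ a) < β (σ a')
        σ-mono a a' lt = rankβ-reflects (σ a) (σ a')
          (subst₂ (λ r r' → toℕ r ℕ.< toℕ r') (sym (rank-σ a)) (sym (rank-σ a')) (Rα.rank-mono lt))

lookup-injective : ∀ {A : Set} {xs : List A} → Unique xs → Injective _≡_ _≡_ (lookup xs)
lookup-injective {xs = _ ∷ _}  (_ ∷ u)   {zero}  {zero}  _  = refl
lookup-injective {xs = _ ∷ xs} (x∉ ∷ _)  {zero}  {suc j} eq =
  ⊥-elim (All.lookup x∉ (ListMemP.∈-lookup j) eq)
lookup-injective {xs = _ ∷ xs} (x∉ ∷ _)  {suc i} {zero}  eq =
  ⊥-elim (All.lookup x∉ (ListMemP.∈-lookup i) (sym eq))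
lookup-injective {xs = _ ∷ _}  (_ ∷ u)   {suc i} {suc j} eq = cong suc (lookup-injective u eq)

position : ∀ {A : Set} {xs : List A} {x : A} → x ListMem.∈ xs → Fin (length xs)
position = Any.index

lookup-position : ∀ {A : Set} {xs : List A} {x : A} (x∈ : x ListMem.∈ xs) →
  lookup xs (position x∈) ≡ x
lookup-position x∈ = sym (AnyP.lookup-index x∈)

_↪_ : FinTour → FinTour → Set
X ↪ Y = Σ[ f ∈ (Fin (size X) → Fin (size Y)) ]
  Injective _≡_ _≡_ f × (∀ a b → e X a b ≡ e Y (f a) (f b))

↪-trans : ∀ {X Y Z} → X ↪ Y → Y ↪ Z → X ↪ Z
↪-trans (f , f-inj , f-e) (g , g-inj , g-e) =
  (λ a → g (f a)) , (λ eq → f-inj (g-inj eq)) , λ a b → trans (f-e a b) (g-e _ _)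

pullback : ∀ {k X Y} → X ↪ Y → Exp k Y → Exp k X
pullback (f , _) y = exp (λ a b → l y (f a) (f b)) (λ r a → p y r (f a))

pullback-embeds : ∀ {k X Y} (φ : X ↪ Y) (y : Exp k Y) → EmbedsFin X (pullback φ y) Y y
pullback-embeds (f , f-inj , f-e) y = f , f-inj , f-e , (λ _ _ → refl) , (λ _ _ → refl)

EmbedsFin-trans : ∀ {k X Y Z} {x : Exp k X} {y : Exp k Y} {z : Exp k Z} →
  EmbedsFin X x Y y → EmbedsFin Y y Z z → EmbedsFin X x Z z
EmbedsFin-trans (f , f-inj , f-e , f-l , f-p) (g , g-inj , g-e , g-l , g-p) =
  (λ a → g (f a)) , (λ eq → f-inj (g-inj eq)) ,
  (λ a b → trans (f-e a b) (g-e _ _)) , (λ a b → trans (f-l a b) (g-l _ _)) ,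
  (λ r a → trans (f-p r a) (g-p r _))

induced : (X : FinTour) → List (Fin (size X)) → FinTour
induced X vs = finTour (length vs) (λ s t → e X (lookup vs s) (lookup vs t))

inclusion : ∀ X {vs} → Unique vs → induced X vs ↪ X
inclusion X {vs} u = lookup vs , lookup-injective u , λ _ _ → refl

-- N disjoint copies of a finite structure Y; combine c d is the copy c of d.
copyEdge : ∀ {N} Y → Fin N × Fin (size Y) → Fin N × Fin (size Y) → Bool
copyEdge Y (c , d) (c' , d') = ⌊ c FinP.≟ c' ⌋ ∧ e Y d d'

copies : ℕ → FinTour → FinTour
copies N Y = finTour (N * size Y)
  (λ u v → copyEdge {N} Y (remQuot (size Y) u) (remQuot (size Y) v))

copies-combine : ∀ {N} Y (c c' : Fin N) d d' →
  e (copies N Y) (combine c d) (combine c' d') ≡ copyEdge Y (c , d) (c' , d')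
copies-combine {N} Y c c' d d' =
  cong₂ (copyEdge {N} Y) (FinP.remQuot-combine {N} {size Y} c d)
                         (FinP.remQuot-combine {N} {size Y} c' d')

copy : ∀ {N} Y → Fin N → Y ↪ copies N Y
copy {N} Y c = combine c , combine-injective , edges
  where
  combine-injective : Injective _≡_ _≡_ (combine {N} {size Y} c)
  combine-injective eq = proj₂ (FinP.combine-injective c _ c _ eq)
  same-copy : ∀ d d' → copyEdge Y (c , d) (c , d') ≡ e Y d d'
  same-copy d d' = cong (_∧ e Y d d') (⌊⌋-true (c FinP.≟ c) refl)
  edges : ∀ d d' → e Y d d' ≡ e (copies N Y) (combine c d) (combine c d')
  edges d d' = sym (trans (copies-combine Y c c d d') (same-copy d d'))

-- Any two distinct vertices are joined by an arc.  (Stated negatively, so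
-- that no decidability of E is required.)
IsTournament : Tour → Set
IsTournament Tr = ∀ u v → u ≢ v → ¬ Tour.E Tr u v → ¬ Tour.E Tr v u → ⊥

module Blocks (Tr : Tour) where

  block : ∀ {X} → EmbedsT X (Iω Tr) → Fin (size X) → ℕ
  block G a = proj₁ (proj₁ G a)

  arc⇒sameBlock : ∀ {X} (G : EmbedsT X (Iω Tr)) a b → T (e X a b) → block G a ≡ block G b
  arc⇒sameBlock (_ , _ , g-e) a b arc = proj₁ (proj₁ (g-e a b) arc)

  -- In a tournament the block partition of an embedded finite structure does
  -- not depend on the embedding: arcs never cross blocks, and two distinct
  -- vertices in a common block are joined by an arc.
  blocks-agree : ∀ {X} → IsTournament Tr → (G H : EmbedsT X (Iω Tr)) →
    ∀ a b → block G a ≡ block G b → block H a ≡ block H b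
  blocks-agree tournament G@(g , g-inj , g-e) H a b sameG
    with a FinP.≟ b | block H a ℕ.≟ block H b
  ... | yes refl | _          = refl
  ... | no _     | yes sameH  = sameH
  ... | no a≢b   | no apartH  =
    ⊥-elim (tournament (proj₂ (g a)) (proj₂ (g b)) distinct noArc noArc')
    where
    distinct : proj₂ (g a) ≢ proj₂ (g b)
    distinct eq = a≢b (g-inj (cong₂ _,_ sameG eq))
    noArc : ¬ Tour.E Tr (proj₂ (g a)) (proj₂ (g b))
    noArc arc = apartH (arc⇒sameBlock H a b (proj₂ (g-e a b) (sameG , arc)))
    noArc' : ¬ Tour.E Tr (proj₂ (g b)) (proj₂ (g a))
    noArc' arc = apartH (sym (arc⇒sameBlock H b a (proj₂ (g-e b a) (sym sameG , arc))))

  inBlock : ∀ {X Y} (G : EmbedsT Y (Iω Tr)) (φ : X ↪ Y) →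
    (∀ a b → block G (proj₁ φ a) ≡ block G (proj₁ φ b)) → EmbedsT X Tr
  inBlock (g , g-inj , g-e) (f , f-inj , f-e) same =
    (λ a → proj₂ (g (f a))) ,
    (λ eq → f-inj (g-inj (cong₂ _,_ (same _ _) eq))) ,
    λ a b → (λ arc → proj₂ (proj₁ (g-e (f a) (f b)) (subst T (f-e a b) arc))) ,
            (λ arc → subst T (sym (f-e a b)) (proj₂ (g-e (f a) (f b)) (same a b , arc)))

  copies-embed : ∀ N Y → EmbedsT Y Tr → EmbedsT (copies N Y) (Iω Tr)
  copies-embed N Y (g , g-inj , g-e) = f , f-inj , f-e
    where
    split : Fin (N * size Y) → Fin N × Fin (size Y)
    split = remQuot {N} (size Y)
    f : Fin (N * size Y) → ℕ × Tour.Car Tr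
    f u = toℕ (proj₁ (split u)) , g (proj₂ (split u))
    f-inj : Injective _≡_ _≡_ f
    f-inj {u} {v} eq = begin
      u                                            ≡⟨ FinP.combine-remQuot {N} (size Y) u ⟨
      combine (proj₁ (split u)) (proj₂ (split u))
        ≡⟨ cong₂ combine (FinP.toℕ-injective (cong proj₁ eq)) (g-inj (cong proj₂ eq)) ⟩
      combine (proj₁ (split v)) (proj₂ (split v))  ≡⟨ FinP.combine-remQuot {N} (size Y) v ⟩
      v                                            ∎
      where open ≡-Reasoning
    edge : ∀ (cd cd' : Fin N × Fin (size Y)) → T (copyEdge {N} Y cd cd') ⟺
      (toℕ (proj₁ cd) ≡ toℕ (proj₁ cd') × Tour.E Tr (g (proj₂ cd)) (g (proj₂ cd')))
    edge (c , d) (c' , d') =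
      (λ t → let (c≡c' , arc) = Equivalence.to BoolP.T-∧ t in
             cong toℕ (toWitness c≡c') , proj₁ (g-e d d') arc) ,
      (λ (c≡c' , arc) → Equivalence.from BoolP.T-∧
                           (fromWitness (FinP.toℕ-injective c≡c') , proj₂ (g-e d d') arc))
    f-e : ∀ u v → T (e (copies N Y) u v) ⟺ Tour.E (Iω Tr) (f u) (f v)
    f-e u v = edge (split u) (split v)

  copies-block : ∀ N Y (G : EmbedsT Y Tr) c d → block (copies-embed N Y G) (combine c d) ≡ toℕ c
  copies-block N Y G c d = cong (toℕ ∘′ proj₁) (FinP.remQuot-combine {N} {size Y} c d)

module ExpandedBlocks {k : ℕ} (M : Str k) {_≺_ : ℕ → ℕ → Set}
                      (sto : IsStrictTotalOrder _≡_ _≺_) where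

  open IsStrictTotalOrder sto using (compare; irrefl; asym)
  open Blocks (reduct M)

  forget : ∀ {X x} → EmbedsS X x (Iω* _≺_ M) → EmbedsT X (Iω (reduct M))
  forget (f , f-inj , f-e , _) = f , f-inj , f-e

  blockˢ : ∀ {X x} → EmbedsS X x (Iω* _≺_ M) → Fin (size X) → ℕ
  blockˢ F = block (forget F)

  order-within : ∀ {P Q : Set} {i j} → i ≡ j → P ⟺ (i ≺ j ⊎ (i ≡ j × Q)) → P ⟺ Q
  order-within i≡j (to , from) = within ∘′ to , λ q → from (inj₂ (i≡j , q))
    where
    within : _ ⊎ _ → _
    within (inj₁ i≺j) = ⊥-elim (irrefl i≡j i≺j)
    within (inj₂ (_ , q)) = q

  order-across : ∀ {P Q : Set} {i j} → i ≢ j → P ⟺ (i ≺ j ⊎ (i ≡ j × Q)) → P ⟺ i ≺ j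
  order-across i≢j (to , from) = across ∘′ to , λ i≺j → from (inj₁ i≺j)
    where
    across : _ ⊎ _ → _
    across (inj₁ i≺j) = i≺j
    across (inj₂ (i≡j , _)) = ⊥-elim (i≢j i≡j)

  inBlockˢ : ∀ {X Y y} (F : EmbedsS Y y (Iω* _≺_ M)) (φ : X ↪ Y) →
    (∀ a b → blockˢ F (proj₁ φ a) ≡ blockˢ F (proj₁ φ b)) → EmbedsS X (pullback φ y) M
  inBlockˢ F@(f , _ , _ , f-l , f-p) φ same =
    let (h , h-inj , h-e) = inBlock (forget F) φ same in
    h , h-inj , h-e ,
    (λ a b → order-within (same a b) (f-l (proj₁ φ a) (proj₁ φ b))) ,
    (λ r a → f-p r (proj₁ φ a))

  glue : ∀ {X Y x y} (F : EmbedsS X x (Iω* _≺_ M)) (H : EmbedsS Y y (Iω* _≺_ M))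
    (φ : Fin (size X) → Fin (size Y)) →
    (∀ a a' → blockˢ F a ≡ blockˢ F a' → φ a ≡ φ a' → a ≡ a') →
    (∀ a a' → blockˢ F a ≡ blockˢ F a' → e X a a' ≡ e Y (φ a) (φ a')) →
    (∀ a a' → blockˢ F a ≡ blockˢ F a' → l x a a' ≡ l y (φ a) (φ a')) →
    (∀ r a → p x r a ≡ p y r (φ a)) →
    (∀ a a' → blockˢ F a ≺ blockˢ F a' → blockˢ H (φ a) ≺ blockˢ H (φ a')) →
    EmbedsFin X x Y y
  glue {X} {Y} {x} {y} F@(_ , _ , _ , f-l , _) H@(_ , _ , _ , h-l , _) φ
       φ-inj φ-e φ-l φ-p φ-mono = φ , injective , edges , order , φ-p
    where
    separate : ∀ a a' → blockˢ F a ≢ blockˢ F a' → blockˢ H (φ a) ≢ blockˢ H (φ a')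
    separate a a' apart with compare (blockˢ F a) (blockˢ F a')
    ... | tri< lt _ _ = λ eq → irrefl eq (φ-mono a a' lt)
    ... | tri≈ _ eq _ = ⊥-elim (apart eq)
    ... | tri> _ _ gt = λ eq → irrefl (sym eq) (φ-mono a' a gt)

    reflect : ∀ a a' → blockˢ F a ≢ blockˢ F a' →
      blockˢ H (φ a) ≺ blockˢ H (φ a') → blockˢ F a ≺ blockˢ F a'
    reflect a a' apart lt with compare (blockˢ F a) (blockˢ F a')
    ... | tri< lt' _ _ = lt'
    ... | tri≈ _ eq _ = ⊥-elim (apart eq)
    ... | tri> _ _ gt = ⊥-elim (asym lt (φ-mono a' a gt))

    injective : Injective _≡_ _≡_ φ
    injective {a} {a'} eq with blockˢ F a ℕ.≟ blockˢ F a'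
    ... | yes same = φ-inj a a' same eq
    ... | no apart = ⊥-elim (separate a a' apart (cong (blockˢ H) eq))

    edges : ∀ a a' → e X a a' ≡ e Y (φ a) (φ a')
    edges a a' with blockˢ F a ℕ.≟ blockˢ F a'
    ... | yes same = φ-e a a' same
    ... | no apart = T-extensional
      (λ arc → ⊥-elim (apart (arc⇒sameBlock (forget F) a a' arc)))
      (λ arc → ⊥-elim (separate a a' apart (arc⇒sameBlock (forget H) (φ a) (φ a') arc)))

    order : ∀ a a' → l x a a' ≡ l y (φ a) (φ a')
    order a a' with blockˢ F a ℕ.≟ blockˢ F a'
    ... | yes same = φ-l a a' same
    ... | no apart = T-extensional
      (λ t → proj₂ (h-l (φ a) (φ a')) (inj₁ (φ-mono a a' (proj₁ (order-across apart (f-l a a')) t))))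
      (λ t → proj₂ (f-l a a') (inj₁ (reflect a a' apart
               (proj₁ (order-across (separate a a' apart) (h-l (φ a) (φ a'))) t))))

JointEmbedding₂ : Tour → Set
JointEmbedding₂ Tr = ∀ X Y → EmbedsT X Tr → EmbedsT Y Tr →
  Σ[ Z ∈ FinTour ] EmbedsT Z Tr × X ↪ Z × Y ↪ Z

JointEmbedding : Tour → Set
JointEmbedding Tr = ∀ m (Xs : Fin m → FinTour) → (∀ j → EmbedsT (Xs j) Tr) →
  Σ[ Z ∈ FinTour ] EmbedsT Z Tr × (∀ j → Xs j ↪ Z)

jointEmbedding : ∀ {Tr} → JointEmbedding₂ Tr → JointEmbedding Tr
jointEmbedding join zero Xs _ =
  finTour 0 (λ ()) , ((λ ()) , (λ { {()} }) , (λ ())) , λ ()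
jointEmbedding {Tr} join (suc m) Xs Xs-embed
  with jointEmbedding {Tr} join m (λ j → Xs (suc j)) (λ j → Xs-embed (suc j))
... | Z , Z-embeds , tail↪Z with join (Xs zero) Z (Xs-embed zero) Z-embeds
...   | W , W-embeds , head↪W , Z↪W = W , W-embeds , into
  where
  into : ∀ j → Xs j ↪ W
  into zero = head↪W
  into (suc j) = ↪-trans {Xs (suc j)} {Z} {W} (tail↪Z j) Z↪W

-- Joint embedding in a structure with decidable equality and arcs: the
-- union of two finite substructures is again one.
module DecidableJoin (Tr : Tour) (_≟_ : DecidableEquality (Tour.Car Tr))
                     (E? : ∀ u v → Dec (Tour.E Tr u v)) where

  onList : List (Tour.Car Tr) → FinTour
  onList us = finTour (length us) (λ s t → ⌊ E? (lookup us s) (lookup us t) ⌋)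

  onList-embeds : ∀ {us} → Unique us → EmbedsT (onList us) Tr
  onList-embeds {us} u = lookup us , lookup-injective u , λ s t → toWitness , fromWitness

  into-onList : ∀ {X us} (G : EmbedsT X Tr) → (∀ a → proj₁ G a ListMem.∈ us) → X ↪ onList us
  into-onList {X} {us} (g , g-inj , g-e) listed =
    (λ a → position (listed a)) ,
    (λ eq → g-inj (trans (sym (back _)) (trans (cong (lookup us) eq) (back _)))) ,
    λ a b → trans (reflects⇒≡⌊⌋ (g-e a b) (E? (g a) (g b)))
                  (cong₂ (λ u v → ⌊ E? u v ⌋) (sym (back a)) (sym (back b)))
    where
    back : ∀ a → lookup us (position (listed a)) ≡ g a
    back a = lookup-position (listed a)

  join : JointEmbedding₂ Tr
  join X Y G@(g , _) H@(h , _) =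
    onList union , onList-embeds (DedupP.deduplicate-! _≟_ both) ,
    into-onList G (λ a → ListMemP.∈-deduplicate⁺ _≟_ (ListMemP.∈-++⁺ˡ (ListMemP.∈-tabulate⁺ a))) ,
    into-onList H
      (λ b → ListMemP.∈-deduplicate⁺ _≟_ (ListMemP.∈-++⁺ʳ (tabulate g) (ListMemP.∈-tabulate⁺ b)))
    where
    both union : List (Tour.Car Tr)
    both = tabulate g ++ tabulate h
    union = deduplicate _≟_ both

module IωExpansion {k : ℕ} (M : Str k) {_≺_ : ℕ → ℕ → Set}
                   (sto : IsStrictTotalOrder _≡_ _≺_)
                   (tournament : IsTournament (reduct M))
                   (joint : JointEmbedding (reduct M))
                   (ep : ExpansionProperty (reduct M) M) where

  open Blocks (reduct M)
  open ExpandedBlocks M sto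
  open OrderMatching sto using (orderMatch)

  module Witness {n : ℕ} (eA : Fin (suc n) → Fin (suc n) → Bool)
                 (G : EmbedsT (finTour (suc n) eA) (Iω (reduct M))) where

    N : ℕ
    N = suc n

    A : FinTour
    A = finTour N eA

    inBlock? : ∀ i (a : Fin N) → Dec (block G a ≡ i)
    inBlock? i a = block G a ℕ.≟ i

    members : ℕ → List (Fin N)
    members i = filter (inBlock? i) (allFin N)

    class : ℕ → FinTour
    class i = induced A (members i)

    class↪A : ∀ i → class i ↪ A
    class↪A i = inclusion A (UniqueP.filter⁺ (inBlock? i) (UniqueP.allFin⁺ N))

    member-block : ∀ i s → block G (lookup (members i) s) ≡ i
    member-block i s =
      proj₂ (ListMemP.∈-filter⁻ (inBlock? i) (ListMemP.∈-lookup {xs = members i} s))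

    member-position : ∀ {i} a → block G a ≡ i → Fin (size (class i))
    member-position {i} a a∈i =
      position (ListMemP.∈-filter⁺ (inBlock? i) (ListMemP.∈-allFin a) a∈i)

    lookup-member-position : ∀ {i} a (a∈i : block G a ≡ i) →
      lookup (members i) (member-position a a∈i) ≡ a
    lookup-member-position {i} a a∈i =
      lookup-position (ListMemP.∈-filter⁺ (inBlock? i) (ListMemP.∈-allFin a) a∈i)

    class-embeds : ∀ i → EmbedsT (class i) (reduct M)
    class-embeds i =
      inBlock G (class↪A i) (λ s t → trans (member-block i s) (sym (member-block i t)))

    wide : ℕ → FinTour
    wide i = proj₁ (ep (class i) (class-embeds i))

    wide-embeds : ∀ i → EmbedsT (wide i) (reduct M)
    wide-embeds i = proj₁ (proj₂ (ep (class i) (class-embeds i)))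

    wide-property : ∀ i (x : Exp k (class i)) → EmbedsS (class i) x M →
      (y : Exp k (wide i)) → EmbedsS (wide i) y M → EmbedsFin (class i) x (wide i) y
    wide-property i = proj₂ (proj₂ (ep (class i) (class-embeds i)))

    -- Hub jointly extends every wide i (one slot per vertex), together with
    -- a class, which makes Hub nonempty.
    parts : Fin (suc N) → FinTour
    parts zero    = class (block G zero)
    parts (suc a) = wide (block G a)

    parts-embed : ∀ j → EmbedsT (parts j) (reduct M)
    parts-embed zero    = class-embeds (block G zero)
    parts-embed (suc a) = wide-embeds (block G a)

    Hub : FinTour
    Hub = proj₁ (joint (suc N) parts parts-embed)

    Hub-embeds : EmbedsT Hub (reduct M)
    Hub-embeds = proj₁ (proj₂ (joint (suc N) parts parts-embed))

    part↪Hub : ∀ j → parts j ↪ Hub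
    part↪Hub = proj₂ (proj₂ (joint (suc N) parts parts-embed))

    d₀ : Fin (size Hub)
    d₀ = proj₁ (part↪Hub zero) (member-position zero refl)

    B : FinTour
    B = copies N Hub

    B-embeds : EmbedsT B (Iω (reduct M))
    B-embeds = copies-embed N Hub Hub-embeds

    pick : ∀ {i} → Dec (∃ λ b → block G b ≡ i) → Fin N
    pick (yes (b , _)) = b
    pick (no _)        = zero

    pick-block : ∀ {i} (d : Dec (∃ λ b → block G b ≡ i)) → ∃ (λ b → block G b ≡ i) →
      block G (pick d) ≡ i
    pick-block (yes (_ , b∈i)) _ = b∈i
    pick-block (no none) some    = ⊥-elim (none some)

    canonical : ℕ → Fin N
    canonical i = pick (FinP.any? (λ b → block G b ℕ.≟ i))

    rep : Fin N → Fin N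
    rep a = canonical (block G a)

    rep-block : ∀ a → block G (rep a) ≡ block G a
    rep-block a = pick-block (FinP.any? (λ b → block G b ℕ.≟ block G a)) (a , refl)

    module Embedding (x : Exp k A) (F : EmbedsS A x (Iω* _≺_ M))
                     (y : Exp k B) (H : EmbedsS B y (Iω* _≺_ M)) where

      G⇒F : ∀ {a a'} → block G a ≡ block G a' → blockˢ F a ≡ blockˢ F a'
      G⇒F = blocks-agree tournament G (forget F) _ _

      F⇒G : ∀ {a a'} → blockˢ F a ≡ blockˢ F a' → block G a ≡ block G a'
      F⇒G = blocks-agree tournament (forget F) G _ _

      copyBlock : Fin N → ℕ
      copyBlock c = blockˢ H (combine c d₀)

      copyBlock-uniform : ∀ c d → blockˢ H (combine c d) ≡ copyBlock c
      copyBlock-uniform c d = blocks-agree tournament B-embeds (forget H) _ _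
        (trans (copies-block N Hub Hub-embeds c d) (sym (copies-block N Hub Hub-embeds c d₀)))

      copyBlock-injective : Injective _≡_ _≡_ copyBlock
      copyBlock-injective {c} {c'} eq = FinP.toℕ-injective (begin
        toℕ c                              ≡⟨ copies-block N Hub Hub-embeds c d₀ ⟨
        block B-embeds (combine c d₀)      ≡⟨ blocks-agree tournament (forget H) B-embeds _ _ eq ⟩
        block B-embeds (combine c' d₀)     ≡⟨ copies-block N Hub Hub-embeds c' d₀ ⟩
        toℕ c'                             ∎)
        where open ≡-Reasoning

      σ : Fin N → Fin N
      σ = proj₁ (orderMatch (blockˢ F) copyBlock copyBlock-injective)

      σ-mono : ∀ a a' → blockˢ F a ≺ blockˢ F a' → copyBlock (σ a) ≺ copyBlock (σ a')
      σ-mono = proj₂ (orderMatch (blockˢ F) copyBlock copyBlock-injective)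

      module Class (ρ : Fin N) where

        i : ℕ
        i = block G ρ

        x↾ : Exp k (class i)
        x↾ = pullback (class↪A i) x

        x↾-embeds : EmbedsS (class i) x↾ M
        x↾-embeds = inBlockˢ F (class↪A i)
          (λ s t → G⇒F (trans (member-block i s) (sym (member-block i t))))

        slot : wide i ↪ B
        slot = ↪-trans {wide i} {Hub} {B} (part↪Hub (suc ρ)) (copy Hub (σ ρ))

        y↾ : Exp k (wide i)
        y↾ = pullback slot y

        y↾-embeds : EmbedsS (wide i) y↾ M
        y↾-embeds = inBlockˢ H slot
          (λ s t → trans (copyBlock-uniform (σ ρ) _) (sym (copyBlock-uniform (σ ρ) _)))

        χ₀ : EmbedsFin (class i) x↾ (wide i) y↾
        χ₀ = wide-property i x↾ x↾-embeds y↾ y↾-embeds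

        χ : EmbedsFin (class i) x↾ B y
        χ = EmbedsFin-trans {Y = wide i} {Z = B} {y = y↾} {z = y} χ₀ (pullback-embeds slot y)

        Φ : ∀ a → block G a ≡ i → Fin (size B)
        Φ a a∈i = proj₁ χ (member-position a a∈i)

        Φ-block : ∀ a a∈i → blockˢ H (Φ a a∈i) ≡ copyBlock (σ ρ)
        Φ-block a a∈i = copyBlock-uniform (σ ρ) (proj₁ (part↪Hub (suc ρ)) (proj₁ χ₀ (member-position a a∈i)))

        module _ (a a' : Fin N) (a∈i : block G a ≡ i) (a'∈i : block G a' ≡ i) where

          private
            s = member-position a a∈i
            s' = member-position a' a'∈i
            back : lookup (members i) s ≡ a
            back = lookup-member-position a a∈i
            back' : lookup (members i) s' ≡ a'
            back' = lookup-member-position a' a'∈i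

          Φ-injective : Φ a a∈i ≡ Φ a' a'∈i → a ≡ a'
          Φ-injective eq = trans (sym back) (trans (cong (lookup (members i)) (proj₁ (proj₂ χ) eq)) back')

          Φ-e : eA a a' ≡ e B (Φ a a∈i) (Φ a' a'∈i)
          Φ-e = trans (cong₂ eA (sym back) (sym back')) (proj₁ (proj₂ (proj₂ χ)) s s')

          Φ-l : l x a a' ≡ l y (Φ a a∈i) (Φ a' a'∈i)
          Φ-l = trans (cong₂ (l x) (sym back) (sym back')) (proj₁ (proj₂ (proj₂ (proj₂ χ))) s s')

        Φ-p : ∀ r a a∈i → p x r a ≡ p y r (Φ a a∈i)
        Φ-p r a a∈i = trans (cong (p x r) (sym (lookup-member-position a a∈i)))
                            (proj₂ (proj₂ (proj₂ (proj₂ χ))) r (member-position a a∈i))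

      φ : Fin N → Fin (size B)
      φ a = Class.Φ (rep a) a (sym (rep-block a))

      Φ-cong : ∀ {ρ ρ'} → ρ ≡ ρ' → ∀ a p p' → Class.Φ ρ a p ≡ Class.Φ ρ' a p'
      Φ-cong refl a p p' = cong (Class.Φ _ a) (ℕP.≡-irrelevant p p')

      φ-in-class : ∀ a a' (same : block G a ≡ block G a') →
        φ a' ≡ Class.Φ (rep a) a' (trans (sym same) (sym (rep-block a)))
      φ-in-class a a' same =
        Φ-cong {rep a'} {rep a} (cong canonical (sym same)) a' (sym (rep-block a'))
               (trans (sym same) (sym (rep-block a)))

      embedding : EmbedsFin A x B y
      embedding = glue F H φ
        (λ a a' sameF eq → Class.Φ-injective (rep a) a a' (sym (rep-block a)) (in-class a a' sameF)
                             (trans eq (φ-in-class a a' (F⇒G sameF))))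
        (λ a a' sameF → trans (Class.Φ-e (rep a) a a' (sym (rep-block a)) (in-class a a' sameF))
                              (cong (e B (φ a)) (sym (φ-in-class a a' (F⇒G sameF)))))
        (λ a a' sameF → trans (Class.Φ-l (rep a) a a' (sym (rep-block a)) (in-class a a' sameF))
                              (cong (l y (φ a)) (sym (φ-in-class a a' (F⇒G sameF)))))
        (λ r a → Class.Φ-p (rep a) r a (sym (rep-block a)))
        (λ a a' lt → subst₂ _≺_ (sym (Class.Φ-block (rep a) a (sym (rep-block a))))
                                (sym (Class.Φ-block (rep a') a' (sym (rep-block a'))))
           (σ-mono (rep a) (rep a') (subst₂ _≺_ (G⇒F (sym (rep-block a))) (G⇒F (sym (rep-block a'))) lt)))
        where
        in-class : ∀ a a' → blockˢ F a ≡ blockˢ F a' → block G a' ≡ block G (rep a)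
        in-class a a' sameF = trans (sym (F⇒G sameF)) (sym (rep-block a))

  iωExpansionProperty : ExpansionProperty (Iω (reduct M)) (Iω* _≺_ M)
  iωExpansionProperty (finTour zero eA) G =
    finTour zero eA , G , λ _ _ _ _ → (λ ()) , (λ { {()} }) , (λ ()) , (λ ()) , (λ _ ())
  iωExpansionProperty (finTour (suc n) eA) G =
    Witness.B eA G , Witness.B-embeds eA G , Witness.Embedding.embedding eA G

I₁-tournament : IsTournament I₁
I₁-tournament _ _ u≢v _ _ = u≢v refl

I₁-joint : JointEmbedding I₁
I₁-joint = jointEmbedding {I₁} (DecidableJoin.join I₁ (λ _ _ → yes refl) (λ _ _ → no (λ ())))

C₃-tournament : IsTournament C₃
C₃-tournament zero             zero             ne _ _ = ne refl
C₃-tournament zero             (suc zero)       _  n _ = n _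
C₃-tournament zero             (suc (suc zero)) _  _ n = n _
C₃-tournament (suc zero)       zero             _  _ n = n _
C₃-tournament (suc zero)       (suc zero)       ne _ _ = ne refl
C₃-tournament (suc zero)       (suc (suc zero)) _  n _ = n _
C₃-tournament (suc (suc zero)) zero             _  n _ = n _
C₃-tournament (suc (suc zero)) (suc zero)       _  _ n = n _
C₃-tournament (suc (suc zero)) (suc (suc zero)) ne _ _ = ne refl

C₃-joint : JointEmbedding C₃
C₃-joint = jointEmbedding {C₃} (DecidableJoin.join C₃ FinP._≟_ (λ u v → BoolP.T? (c3e u v)))

Q-tournament : IsTournament Qt
Q-tournament u v u≢v ¬u<v ¬v<u with ℚP.<-cmp u v
... | tri< u<v _ _ = ¬u<v u<v
... | tri≈ _ u≡v _ = u≢v u≡v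
... | tri> _ _ v<u = ¬v<u v<u

Q-joint : JointEmbedding Qt
Q-joint = jointEmbedding {Qt} (DecidableJoin.join Qt ℚP._≟_ ℚP._<?_)

-- S(2): points of D at angles qπ, q ∈ [0, 2); distinct points are never
-- antipodal, so the counterclockwise angle between them is in (0, π) one
-- way or the other.
module DenseLocalOrder where

  open import Data.Rational using (ℚ; 0ℚ; 1ℚ; _+_; _-_; -_; ↧ₙ_)
  open import Data.Rational.Solver using (module +-*-Solver)
  open +-*-Solver using (solve; _:=_; _:+_; _:-_; :-_)
  import Data.Nat.DivMod as ℕD
  import Data.Integer as ℤ
  import Data.Integer.Properties as ℤP
  open import Data.Bool using (_xor_)

  record InD (q : ℚ) : Set where
    field
      nonneg : 0ℚ ℚ.≤ q
      below2 : q ℚ.< 2ℚ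
      parity : ⌊ q ℚP.<? 1ℚ ⌋ ≡ odd (↧ₙ q)

  xnor⇒≡ : ∀ x y → T (not (x xor y)) → x ≡ y
  xnor⇒≡ false false _ = refl
  xnor⇒≡ true  true  _ = refl

  ∧-split : ∀ x {y} → T (x ∧ y) → T x × T y
  ∧-split true t = _ , t

  inD-facts : ∀ q → T (inD q) → InD q
  inD-facts q q∈D =
    let (t₀ , t₁₂₃) = ∧-split ⌊ 0ℚ ℚP.≤? q ⌋ q∈D
        (t₁ , t₂₃)  = ∧-split ⌊ q ℚP.<? 2ℚ ⌋ t₁₂₃
        (_  , t₃)   = ∧-split (not ⌊ q ℚP.≟ 3/2 ⌋) t₂₃
    in record { nonneg = toWitness t₀ ; below2 = toWitness t₁ ; parity = xnor⇒≡ _ _ t₃ }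

  odd-factor : ∀ m g → T (odd (m * g)) → T (odd m)
  odd-factor m g t = go (m ℕ.% 2) (ℕD.m%n<n m 2) (g ℕ.% 2)
                        (subst (λ z → T (z ℕ.≡ᵇ 1)) (ℕD.%-distribˡ-* m g 2) t)
    where
    go : ∀ r → r ℕ.< 2 → ∀ s → T ((r * s) ℕ.% 2 ℕ.≡ᵇ 1) → T (r ℕ.≡ᵇ 1)
    go 0 _ _ t = t
    go 1 _ _ _ = _
    go (suc (suc _)) (ℕ.s≤s (ℕ.s≤s ())) _ _

  -- The reduced denominator of p + 1 divides that of p.
  odd-den-shift : ∀ p → T (odd (↧ₙ p)) → T (odd (↧ₙ (p + 1ℚ)))
  odd-den-shift p = from-cofactor _ (ℚP.↧-+ p 1ℚ)
    where
    from-cofactor : ∀ g → ℚ.↧ (p + 1ℚ) ℤ.* g ≡ ℚ.↧ p ℤ.* ℚ.↧ 1ℚ →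
      T (odd (↧ₙ p)) → T (odd (↧ₙ (p + 1ℚ)))
    from-cofactor g eq odd-p = odd-factor (↧ₙ (p + 1ℚ)) ℤ.∣ g ∣ (subst (T ∘′ odd) (sym dens) odd-p)
      where
      dens : ↧ₙ (p + 1ℚ) * ℤ.∣ g ∣ ≡ ↧ₙ p
      dens = begin
        ↧ₙ (p + 1ℚ) * ℤ.∣ g ∣                ≡⟨ ℤP.abs-* (ℚ.↧ (p + 1ℚ)) g ⟨
        ℤ.∣ ℚ.↧ (p + 1ℚ) ℤ.* g ∣             ≡⟨ cong ℤ.∣_∣ eq ⟩
        ℤ.∣ ℚ.↧ p ℤ.* ℚ.↧ 1ℚ ∣               ≡⟨ ℤP.abs-* (ℚ.↧ p) (ℚ.↧ 1ℚ) ⟩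
        ↧ₙ p * 1                             ≡⟨ ℕP.*-identityʳ (↧ₙ p) ⟩
        ↧ₙ p                                 ∎
        where open ≡-Reasoning

  -- D contains no antipodal pair p, p + 1: their denominators have the
  -- same parity, which places both or neither in [0, 1).
  no-antipodes : ∀ p q → T (inD p) → T (inD q) → q ≡ p + 1ℚ → ⊥
  no-antipodes p q p∈D q∈D refl = by-cases (p ℚP.<? 1ℚ)
    where
    open InD (inD-facts p p∈D) using (nonneg) renaming (parity to parity-p)
    open InD (inD-facts q q∈D) using (below2) renaming (parity to parity-q)
    by-cases : Dec (p ℚ.< 1ℚ) → ⊥
    by-cases (yes p<1) = ℚP.<-irrefl refl (ℚP.≤-<-trans 1≤q q<1)
      where
      q<1 : q ℚ.< 1ℚ
      q<1 = toWitness (subst T (sym parity-q) (odd-den-shift p (subst T parity-p (fromWitness p<1))))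
      1≤q : 1ℚ ℚ.≤ q
      1≤q = subst (ℚ._≤ q) (ℚP.+-identityˡ 1ℚ) (ℚP.+-monoˡ-≤ 1ℚ nonneg)
    by-cases (no p≮1) = ℚP.<-irrefl refl (ℚP.≤-<-trans (ℚP.+-monoˡ-≤ 1ℚ (ℚP.≮⇒≥ p≮1)) below2)

  sub-antisym : ∀ x y → x - y ≡ - (y - x)
  sub-antisym = solve 2 (λ x y → x :- y := :- (y :- x)) refl

  add-sub : ∀ x y → y ≡ x + (y - x)
  add-sub = solve 2 (λ x y → y := x :+ (y :- x)) refl

  shift : ∀ x y {r} → y - x ≡ r → y ≡ x + r
  shift x y eq = trans (add-sub x y) (cong (x +_) eq)

  S2-tournament : IsTournament S2
  S2-tournament (x , x∈D) (y , y∈D) x≢y ¬xy ¬yx with ℚP.<-cmp (y - x) 0ℚ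
  ... | tri≈ _ y-x≡0 _ = x≢y (same-point (sym (trans (shift x y y-x≡0) (ℚP.+-identityʳ x))))
    where
    same-point : x ≡ y → (x , x∈D) ≡ (y , y∈D)
    same-point refl = cong (x ,_) (BoolP.T-irrelevant x∈D y∈D)
  ... | tri> _ _ y-x>0 with ℚP.<-cmp (y - x) 1ℚ
  ...   | tri< y-x<1 _ _ = ¬xy (inj₁ (y-x>0 , y-x<1))
  ...   | tri≈ _ y-x≡1 _ = no-antipodes x y x∈D y∈D (shift x y y-x≡1)
  ...   | tri> _ _ y-x>1 = ¬yx (inj₂ (subst (ℚ._< -1ℚ) (sym (sub-antisym x y)) (ℚP.neg-antimono-< y-x>1)))
  S2-tournament (x , x∈D) (y , y∈D) x≢y ¬xy ¬yx | tri< y-x<0 _ _ with ℚP.<-cmp (y - x) -1ℚ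
  ...   | tri< y-x<-1 _ _ = ¬xy (inj₂ y-x<-1)
  ...   | tri≈ _ y-x≡-1 _ = no-antipodes y x y∈D x∈D (shift y x (trans (sub-antisym x y) (cong -_ y-x≡-1)))
  ...   | tri> _ _ y-x>-1 = ¬yx (inj₁ (subst (0ℚ ℚ.<_) (sym (sub-antisym x y)) (ℚP.neg-antimono-< y-x<0) ,
                                       subst (ℚ._< 1ℚ) (sym (sub-antisym x y)) (ℚP.neg-antimono-< y-x>-1)))

  S2-joint : JointEmbedding (reduct S2*)
  S2-joint = jointEmbedding {S2} (DecidableJoin.join S2 _≟ᴰ_ E?)
    where
    _≟ᴰ_ : DecidableEquality D
    (x , x∈D) ≟ᴰ (y , y∈D) with x ℚP.≟ y
    ... | yes refl = yes (cong (x ,_) (BoolP.T-irrelevant x∈D y∈D))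
    ... | no x≢y   = no (λ eq → x≢y (cong proj₁ eq))
    E? : ∀ u v → Dec (s2E u v)
    E? (x , _) (y , _) = ((0ℚ ℚP.<? (y - x)) ×-dec ((y - x) ℚP.<? 1ℚ)) ⊎-dec ((y - x) ℚP.<? -1ℚ)

-- T^ω: the age of T^ω* consists of the finite ordered tournaments.  Its
-- members are ordered by ¬¬-decided instances of <, which is enough to
-- conclude Boolean equations.
module GenericTournament (M : Str 0) (lim : IsFraisseLimitOT M) where

  open IsFraisseLimitOT lim using (age)

  ¬¬-decidable : ∀ n (Q : Fin n → Set) → ¬ ¬ (∀ i → Dec (Q i))
  ¬¬-decidable zero    Q k = k (λ ())
  ¬¬-decidable (suc n) Q k = ¬¬-excluded-middle λ d₀ →
    ¬¬-decidable n (λ i → Q (suc i)) λ ds → k λ { zero → d₀ ; (suc i) → ds i }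

  ¬¬-decidable₂ : ∀ m n (Q : Fin m → Fin n → Set) → ¬ ¬ (∀ a b → Dec (Q a b))
  ¬¬-decidable₂ zero    n Q k = k (λ ())
  ¬¬-decidable₂ (suc m) n Q k = ¬¬-decidable n (Q zero) λ d₀ →
    ¬¬-decidable₂ m n (λ a → Q (suc a)) λ ds → k λ { zero → d₀ ; (suc a) → ds a }

  IsBoolTournament : FinTour → Set
  IsBoolTournament X = (∀ a → e X a a ≡ false) × (∀ a b → a ≢ b → e X a b ≡ not (e X b a))

  age-tournament : ∀ X → EmbedsT X (reduct M) → IsBoolTournament X
  age-tournament X (g , g-inj , g-e) = irreflexive , antisymmetric
    where
    ordered : (dL : ∀ a b → Dec (Str.L M (g a) (g b))) →
      IsOrderedTournament X (exp (λ a b → ⌊ dL a b ⌋) (λ ()))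
    ordered dL = proj₁ (age X (exp (λ a b → ⌊ dL a b ⌋) (λ ())))
                       (g , g-inj , g-e , (λ a b → toWitness , fromWitness) , (λ ()))
    by-ordering : ∀ {x y : Bool} → ((dL : ∀ a b → Dec (Str.L M (g a) (g b))) → x ≡ y) → x ≡ y
    by-ordering {x} {y} eq = decidable-stable (x BoolP.≟ y)
      λ x≢y → ¬¬-decidable₂ _ _ (λ a b → Str.L M (g a) (g b)) λ dL → x≢y (eq dL)
    irreflexive : ∀ a → e X a a ≡ false
    irreflexive a = by-ordering λ dL → proj₁ (ordered dL) a
    antisymmetric : ∀ a b → a ≢ b → e X a b ≡ not (e X b a)
    antisymmetric a b a≢b = by-ordering λ dL → proj₁ (proj₂ (ordered dL)) a b a≢b

  tournament : IsTournament (reduct M)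
  tournament u v u≢v ¬uv ¬vu =
    ¬¬-decidable₂ 2 2 (λ a b → Str.E M (pair a) (pair b)) λ dE →
      let X = finTour 2 (λ a b → ⌊ dE a b ⌋)
          antisymmetric = proj₂ (age-tournament X (pair , pair-injective , λ a b → toWitness , fromWitness))
      in false≢true (begin
        false                       ≡⟨ ⌊⌋-false (dE zero (suc zero)) ¬uv ⟨
        ⌊ dE zero (suc zero) ⌋      ≡⟨ antisymmetric zero (suc zero) (λ ()) ⟩
        not ⌊ dE (suc zero) zero ⌋  ≡⟨ cong not (⌊⌋-false (dE (suc zero) zero) ¬vu) ⟩
        true                        ∎)
    where
    open ≡-Reasoning
    pair : Fin 2 → Str.Car M
    pair zero    = u
    pair (suc _) = v
    pair-injective : Injective _≡_ _≡_ pair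
    pair-injective {zero}     {zero}     _  = refl
    pair-injective {zero}     {suc zero} eq = ⊥-elim (u≢v eq)
    pair-injective {suc zero} {zero}     eq = ⊥-elim (u≢v (sym eq))
    pair-injective {suc zero} {suc zero} _  = refl
    false≢true : false ≡ true → ⊥
    false≢true ()

  sumEdge : ∀ X Y → Fin (size X) ⊎ Fin (size Y) → Fin (size X) ⊎ Fin (size Y) → Bool
  sumEdge X Y (inj₁ a) (inj₁ b) = e X a b
  sumEdge X Y (inj₂ a) (inj₂ b) = e Y a b
  sumEdge X Y (inj₁ _) (inj₂ _) = true
  sumEdge X Y (inj₂ _) (inj₁ _) = false

  _⊕_ : FinTour → FinTour → FinTour
  X ⊕ Y = finTour (size X ℕ.+ size Y) (λ u v → sumEdge X Y (splitAt (size X) u) (splitAt (size X) v))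

  ⊕-tournament : ∀ X Y → IsBoolTournament X → IsBoolTournament Y → IsBoolTournament (X ⊕ Y)
  ⊕-tournament X Y (irrX , antiX) (irrY , antiY) =
    (λ u → irreflexive (splitAt (size X) u)) ,
    (λ u v u≢v → antisymmetric (splitAt (size X) u) (splitAt (size X) v)
       (λ eq → u≢v (trans (sym (FinP.join-splitAt (size X) (size Y) u))
                    (trans (cong (Fin.join (size X) (size Y)) eq) (FinP.join-splitAt (size X) (size Y) v)))))
    where
    irreflexive : ∀ s → sumEdge X Y s s ≡ false
    irreflexive (inj₁ a) = irrX a
    irreflexive (inj₂ a) = irrY a
    antisymmetric : ∀ s t → s ≢ t → sumEdge X Y s t ≡ not (sumEdge X Y t s)
    antisymmetric (inj₁ a) (inj₁ b) s≢t = antiX a b (λ eq → s≢t (cong inj₁ eq))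
    antisymmetric (inj₂ a) (inj₂ b) s≢t = antiY a b (λ eq → s≢t (cong inj₂ eq))
    antisymmetric (inj₁ _) (inj₂ _) _ = refl
    antisymmetric (inj₂ _) (inj₁ _) _ = refl

  fin-ordered : ∀ X → IsBoolTournament X → IsOrderedTournament X (exp (λ u v → ⌊ u FinP.<? v ⌋) (λ ()))
  fin-ordered X (irr , anti) =
    irr , anti ,
    (λ u → ⌊⌋-false (u FinP.<? u) (FinP.<-irrefl refl)) ,
    (λ u v w u<v v<w → ⌊⌋-true (u FinP.<? w) (FinP.<-trans (⌊⌋-true⁻¹ (u FinP.<? v) u<v)
                                                          (⌊⌋-true⁻¹ (v FinP.<? w) v<w))) ,
    antisymmetric
    where
    antisymmetric : ∀ u v → u ≢ v → ⌊ u FinP.<? v ⌋ ≡ not ⌊ v FinP.<? u ⌋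
    antisymmetric u v u≢v with FinP.<-cmp u v
    ... | tri< u<v _ v≮u = trans (⌊⌋-true (u FinP.<? v) u<v) (cong not (sym (⌊⌋-false (v FinP.<? u) v≮u)))
    ... | tri≈ _ u≡v _   = ⊥-elim (u≢v u≡v)
    ... | tri> u≮v _ v<u = trans (⌊⌋-false (u FinP.<? v) u≮v) (cong not (sym (⌊⌋-true (v FinP.<? u) v<u)))

  join : JointEmbedding₂ (reduct M)
  join X Y G H = X ⊕ Y , sum-embeds , left , right
    where
    sum-embeds : EmbedsT (X ⊕ Y) (reduct M)
    sum-embeds with proj₂ (age (X ⊕ Y) (exp (λ u v → ⌊ u FinP.<? v ⌋) (λ ())))
                      (fin-ordered (X ⊕ Y) (⊕-tournament X Y (age-tournament X G) (age-tournament Y H)))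
    ... | f , f-inj , f-e , _ = f , f-inj , f-e
    left : X ↪ (X ⊕ Y)
    left = (_↑ˡ size Y) , (λ {a} {b} → FinP.↑ˡ-injective (size Y) a b) ,
      λ a b → sym (cong₂ (sumEdge X Y) (FinP.splitAt-↑ˡ (size X) a (size Y))
                                       (FinP.splitAt-↑ˡ (size X) b (size Y)))
    right : Y ↪ (X ⊕ Y)
    right = (size X ↑ʳ_) , (λ {a} {b} → FinP.↑ʳ-injective (size X) a b) ,
      λ a b → sym (cong₂ (sumEdge X Y) (FinP.splitAt-↑ʳ (size X) (size Y) a)
                                       (FinP.splitAt-↑ʳ (size X) (size Y) b))

theorem7p5 : (_≺_ : ℕ → ℕ → Set) → DenseLinearOrder _≺_ →
    (ExpansionProperty I₁ I₁* → ExpansionProperty (Iω I₁) (Iω* _≺_ I₁*)) ×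
    (ExpansionProperty C₃ C₃* → ExpansionProperty (Iω C₃) (Iω* _≺_ C₃*)) ×
    (ExpansionProperty Qt Q* → ExpansionProperty (Iω Qt) (Iω* _≺_ Q*)) ×
    (ExpansionProperty S2 S2* → ExpansionProperty (Iω S2) (Iω* _≺_ S2*)) ×
    ((Tω* : Str 0) → IsFraisseLimitOT Tω* →
      ExpansionProperty (reduct Tω*) Tω* →
      ExpansionProperty (Iω (reduct Tω*)) (Iω* _≺_ Tω*))
theorem7p5 _≺_ dlo =
  lift I₁* I₁-tournament I₁-joint ,
  lift C₃* C₃-tournament C₃-joint ,
  lift Q* Q-tournament Q-joint ,
  lift S2* DenseLocalOrder.S2-tournament DenseLocalOrder.S2-joint ,
  λ Tω* lim → lift Tω* (GenericTournament.tournament Tω* lim)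
                       (jointEmbedding {reduct Tω*} (GenericTournament.join Tω* lim))
  where
  lift : ∀ {k} (M : Str k) → IsTournament (reduct M) → JointEmbedding (reduct M) →
    ExpansionProperty (reduct M) M → ExpansionProperty (Iω (reduct M)) (Iω* _≺_ M)
  lift M tournament joint =
    IωExpansion.iωExpansionProperty M (DenseLinearOrder.isStrictTotalOrder dlo) tournament joint
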